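{- For each $k\ge0$, the sequence $C(0,k),C(1,k),C(2,k),\dots$ is log-concave.
   Context: For $n,k\ge0$, $C(n,k)$ is the number of $(x_1,\dots,x_{k+1})\in\mathbb{Z}^{k+1}$ with $|x_1|+\cdots+|x_{k+1}|=n$; equivalently $\sum_{n,k\ge0}C(n,k)x^ny^k=\frac{1+x}{1-x-y-xy}$. A sequence $(a_k)_{k\ge0}$ of nonnegative numbers is log-concave if $a_{k-1}a_{k+1}\le a_k^2$ for all $k\ge1$. -}

module Defs where

open import Data.Nat using (ℕ; zero; suc; _+_; _*_; _≤_)

-- absCount j = number of integers x with |x| = j  (1 if j = 0, else 2: x = j, x = -j)
absCount : ℕ → ℕ
absCount zero    = 1
absCount (suc _) = 2

-- C n k = number of (x₁,…,x_{k+1}) ∈ ℤ^{k+1} with |x₁|+⋯+|x_{k+1}| = n.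
-- Counted by splitting on the first coordinate x₁ with |x₁| = j:
--   C n 0       = absCount n
--   C n (k + 1) = Σ_{j=0}^{n} absCount j * C (n - j) k
-- sumSplit n k implements Σ_{j+m=n} absCount j * C m k by recursion on n.
mutual
  C : ℕ → ℕ → ℕ
  C n zero    = absCount n
  C n (suc k) = split n zero k

  split : ℕ → ℕ → ℕ → ℕ
  split zero    j k = absCount j * C zero k
  split (suc m) j k = absCount j * C (suc m) k + split m (suc j) k

LogConcave : (ℕ → ℕ) → Set
LogConcave a = ∀ i → a i * a (suc (suc i)) ≤ a (suc i) * a (suc i)

{-# OPTIONS --safe #-}
-- Splitting off one coordinate gives Σₙ C(n,k+1) xⁿ = (1 + x)/(1 − x) · Σₙ C(n,k) xⁿ,
-- so C(·,k+1) is obtained from C(·,k) by taking partial sums and then sums of adjacent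
-- terms.  Both operations preserve log-concavity of sequences of positive terms, and
-- C(·,0) = 1, 2, 2, 2, … is positive and log-concave.
module Submission where

open import Defs
open import Data.Nat
open import Data.Nat.Properties
open import Data.Product using (_×_; _,_; proj₁)
open import Relation.Binary.PropositionalEquality
open import Data.Nat.Tactic.RingSolver using (solve-∀)

Positive : (ℕ → ℕ) → Set
Positive a = ∀ n → 0 < a n

partialSums : (ℕ → ℕ) → ℕ → ℕ
partialSums a zero    = a zero
partialSums a (suc n) = partialSums a n + a (suc n)

adjacentSums : (ℕ → ℕ) → ℕ → ℕ
adjacentSums a zero    = a zero
adjacentSums a (suc n) = a (suc n) + a n

LogConcave-resp : ∀ {a b} → (∀ n → a n ≡ b n) → LogConcave a → LogConcave b
LogConcave-resp a≗b lc i =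
  subst₂ _≤_ (cong₂ _*_ (a≗b i) (a≗b (suc (suc i))))
             (cong₂ _*_ (a≗b (suc i)) (a≗b (suc i))) (lc i)

Positive-resp : ∀ {a b} → (∀ n → a n ≡ b n) → Positive a → Positive b
Positive-resp a≗b pos n = subst (0 <_) (a≗b n) (pos n)

module _ {a : ℕ → ℕ} (lc : LogConcave a) (pos : Positive a) where
  open ≤-Reasoning

  -- Positivity is what lets us cancel a n; log-concavity alone does not propagate past a zero.
  logConcave-outer≤inner : ∀ m t → a m * a (suc (suc (t + m))) ≤ a (suc m) * a (suc (t + m))
  logConcave-outer≤inner m zero    = lc m
  logConcave-outer≤inner m (suc t) = *-cancelˡ-≤ (a n) {{>-nonZero (pos n)}} (begin
      a n * (a m * a (suc (suc n)))   ≡⟨ swap (a n) (a m) _ ⟩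
      a m * (a n * a (suc (suc n)))   ≤⟨ *-monoʳ-≤ (a m) (lc n) ⟩
      a m * (a (suc n) * a (suc n))   ≡⟨ *-assoc (a m) _ _ ⟨
      (a m * a (suc n)) * a (suc n)   ≤⟨ *-monoˡ-≤ (a (suc n)) (logConcave-outer≤inner m t) ⟩
      (a (suc m) * a n) * a (suc n)   ≡⟨ rotate (a (suc m)) (a n) (a (suc n)) ⟩
      a n * (a (suc m) * a (suc n))   ∎)
    where
    n : ℕ
    n = suc (t + m)
    swap : ∀ x y z → x * (y * z) ≡ y * (x * z)
    swap = solve-∀
    rotate : ∀ x y z → (x * y) * z ≡ y * (x * z)
    rotate = solve-∀

  private
    S : ℕ → ℕ
    S = partialSums a

  partialSums-outer≤inner : ∀ j t → S j * a (suc (suc (t + j))) ≤ S (suc j) * a (suc (t + j))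
  partialSums-outer≤inner zero t = begin
      a 0 * a (suc (suc (t + 0)))     ≤⟨ logConcave-outer≤inner 0 t ⟩
      a 1 * a (suc (t + 0))           ≤⟨ *-monoˡ-≤ _ (m≤n+m (a 1) (a 0)) ⟩
      (a 0 + a 1) * a (suc (t + 0))   ∎
  partialSums-outer≤inner (suc j) t = begin
      (S j + a (suc j)) * a (suc (suc n))
        ≡⟨ *-distribʳ-+ _ (S j) (a (suc j)) ⟩
      S j * a (suc (suc n)) + a (suc j) * a (suc (suc n))
        ≤⟨ +-mono-≤ (subst (λ m → S j * a (suc (suc m)) ≤ S (suc j) * a (suc m))
                           (sym (+-suc t j)) (partialSums-outer≤inner j (suc t)))
                    (logConcave-outer≤inner (suc j) t) ⟩
      S (suc j) * a (suc n) + a (suc (suc j)) * a (suc n)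
        ≡⟨ *-distribʳ-+ _ (S (suc j)) (a (suc (suc j))) ⟨
      (S (suc j) + a (suc (suc j))) * a (suc n) ∎
    where
    n : ℕ
    n = t + suc j

  partialSums-logConcave : LogConcave S
  partialSums-logConcave i = begin
      s * ((s + x) + y)          ≡⟨ *-distribˡ-+ s (s + x) y ⟩
      s * (s + x) + s * y        ≤⟨ +-monoʳ-≤ (s * (s + x)) (partialSums-outer≤inner i 0) ⟩
      s * (s + x) + (s + x) * x  ≡⟨ square s x ⟩
      (s + x) * (s + x)          ∎
    where
    s x y : ℕ
    s = S i
    x = a (suc i)
    y = a (suc (suc i))
    square : ∀ s x → s * (s + x) + (s + x) * x ≡ (s + x) * (s + x)
    square = solve-∀

  partialSums-positive : Positive S
  partialSums-positive zero    = pos zero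
  partialSums-positive (suc n) = ≤-trans (partialSums-positive n) (m≤m+n (S n) _)

  adjacentSums-logConcave : LogConcave (adjacentSums a)
  adjacentSums-logConcave zero = begin
      x * (z + y)                    ≡⟨ *-distribˡ-+ x z y ⟩
      x * z + x * y                  ≤⟨ +-monoˡ-≤ (x * y) (lc 0) ⟩
      y * y + x * y                  ≤⟨ m≤m+n _ _ ⟩
      y * y + x * y + (y * x + x * x) ≡⟨ square x y ⟩
      (y + x) * (y + x)              ∎
    where
    x y z : ℕ
    x = a 0
    y = a 1
    z = a 2
    square : ∀ x y → y * y + x * y + (y * x + x * x) ≡ (y + x) * (y + x)
    square = solve-∀
  adjacentSums-logConcave (suc n) = begin
      (x + w) * (z + y)                  ≡⟨ expand w x y z ⟩
      x * z + (w * z + w * y) + x * y    ≤⟨ +-monoˡ-≤ (x * y) (+-mono-≤ (lc (suc n))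
                                              (+-mono-≤ (logConcave-outer≤inner n 1) (lc n))) ⟩
      y * y + (x * y + x * x) + x * y    ≡⟨ square x y ⟩
      (y + x) * (y + x)                  ∎
    where
    w x y z : ℕ
    w = a n
    x = a (suc n)
    y = a (suc (suc n))
    z = a (suc (suc (suc n)))
    expand : ∀ w x y z → (x + w) * (z + y) ≡ x * z + (w * z + w * y) + x * y
    expand = solve-∀
    square : ∀ x y → y * y + (x * y + x * x) + x * y ≡ (y + x) * (y + x)
    square = solve-∀

  adjacentSums-positive : Positive (adjacentSums a)
  adjacentSums-positive zero    = pos zero
  adjacentSums-positive (suc n) = ≤-trans (pos (suc n)) (m≤m+n _ _)

split-suc : ∀ m j k → split m (suc j) k ≡ 2 * partialSums (λ n → C n k) m
split-suc zero    j k = refl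
split-suc (suc m) j k = begin
    2 * C (suc m) k + split m (suc (suc j)) k   ≡⟨ cong (2 * C (suc m) k +_) (split-suc m (suc j) k) ⟩
    2 * C (suc m) k + 2 * S m                   ≡⟨ factor (C (suc m) k) (S m) ⟩
    2 * (S m + C (suc m) k)                     ∎
  where
  open ≡-Reasoning
  S : ℕ → ℕ
  S = partialSums (λ n → C n k)
  factor : ∀ x s → 2 * x + 2 * s ≡ 2 * (s + x)
  factor = solve-∀

C-suc : ∀ k n → adjacentSums (partialSums (λ m → C m k)) n ≡ C n (suc k)
C-suc k zero    = sym (+-identityʳ (C 0 k))
C-suc k (suc n) = begin
    (S n + C (suc n) k) + S n         ≡⟨ rearrange (C (suc n) k) (S n) ⟩
    1 * C (suc n) k + 2 * S n         ≡⟨ cong (1 * C (suc n) k +_) (split-suc n 0 k) ⟨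
    1 * C (suc n) k + split n 1 k     ∎
  where
  open ≡-Reasoning
  S : ℕ → ℕ
  S = partialSums (λ m → C m k)
  rearrange : ∀ x s → (s + x) + s ≡ 1 * x + 2 * s
  rearrange = solve-∀

C-logConcave×positive : ∀ k → LogConcave (λ n → C n k) × Positive (λ n → C n k)
C-logConcave×positive zero = lc₀ , pos₀
  where
  lc₀ : LogConcave (λ n → C n zero)
  lc₀ zero    = s≤s (s≤s z≤n)
  lc₀ (suc i) = ≤-refl
  pos₀ : Positive (λ n → C n zero)
  pos₀ zero    = s≤s z≤n
  pos₀ (suc n) = s≤s z≤n
C-logConcave×positive (suc k) with C-logConcave×positive k
... | lc , pos =
  LogConcave-resp (C-suc k) (adjacentSums-logConcave lcˢ posˢ) ,
  Positive-resp (C-suc k) (adjacentSums-positive lcˢ posˢ)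
  where
  lcˢ : LogConcave (partialSums (λ n → C n k))
  lcˢ = partialSums-logConcave lc pos
  posˢ : Positive (partialSums (λ n → C n k))
  posˢ = partialSums-positive lc pos

mainTheorem10 : ∀ k → LogConcave (λ n → C n k)
mainTheorem10 k = proj₁ (C-logConcave×positive k)
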